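{- For any integers $m,n\ge 2$, $pd_s(P_m\Box P_n)=3$.
   Context: Graphs are finite, simple, connected; $d_G$ is shortest-path distance, $d_G(x,W)=\min\{d_G(x,w):w\in W\}$. A set $W$ strongly resolves different vertices $x,y\notin W$ if $d_G(x,W)=d_G(x,y)+d_G(y,W)$ or $d_G(y,W)=d_G(y,x)+d_G(x,W)$. A vertex partition $\Pi$ is a strong resolving partition if every two different vertices in the same set of $\Pi$ are strongly resolved by some set of $\Pi$; $pd_s(G)$ is the minimum cardinality of such a partition. $P_m$ is the path on $m$ vertices and $\Box$ denotes the Cartesian product of graphs. -}

module Defs where

open import Data.Nat using (ℕ; zero; suc; _+_; _≤_; _<_)
open import Data.Fin using (Fin; toℕ)
open import Data.Product using (Σ; _×_; _,_; ∃)
open import Data.Sum using (_⊎_)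
open import Relation.Nullary using (¬_)
open import Relation.Binary.PropositionalEquality using (_≡_; _≢_)
open import Function.Definitions using (Surjective)

data Walk {V : Set} (Adj : V → V → Set) : V → V → ℕ → Set where
  nil  : ∀ {x} → Walk Adj x x 0
  cons : ∀ {x y z k} → Adj x y → Walk Adj y z k → Walk Adj x z (suc k)

Dist : {V : Set} → (V → V → Set) → V → V → ℕ → Set
Dist Adj x y k = Walk Adj x y k × (∀ j → Walk Adj x y j → k ≤ j)

DistSet : {V : Set} → (V → V → Set) → V → (V → Set) → ℕ → Set
DistSet Adj x W k =
  (Σ _ λ w → W w × Dist Adj x w k) ×
  (∀ w j → W w → Dist Adj x w j → k ≤ j)

StronglyResolves : {V : Set} → (V → V → Set) → (V → Set) → V → V → Set
StronglyResolves Adj W x y =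
  Σ ℕ λ a → Σ ℕ λ b → Σ ℕ λ c →
    DistSet Adj x W a × Dist Adj x y b × DistSet Adj y W c ×
    (a ≡ b + c ⊎ c ≡ b + a)

-- A partition into k (nonempty) sets, given by a surjective class map
-- V → Fin k, is a strong resolving partition if any two different vertices
-- in the same class are strongly resolved by some class (not containing them).
IsStrongResolvingPartition : {V : Set} → (V → V → Set) → (k : ℕ) → (V → Fin k) → Set
IsStrongResolvingPartition Adj k cls =
  ∀ x y → x ≢ y → cls x ≡ cls y →
    Σ (Fin k) λ i → i ≢ cls x × StronglyResolves Adj (λ v → cls v ≡ i) x y

HasStrongResolvingPartition : {V : Set} → (V → V → Set) → ℕ → Set
HasStrongResolvingPartition {V} Adj k =
  Σ (V → Fin k) λ cls → Surjective _≡_ _≡_ cls × IsStrongResolvingPartition Adj k cls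

StrongPartitionDimension : {V : Set} → (V → V → Set) → ℕ → Set
StrongPartitionDimension Adj k =
  HasStrongResolvingPartition Adj k × (∀ j → j < k → ¬ HasStrongResolvingPartition Adj j)

PathAdj : (m : ℕ) → Fin m → Fin m → Set
PathAdj m i j = toℕ j ≡ suc (toℕ i) ⊎ toℕ i ≡ suc (toℕ j)

CartAdj : {A B : Set} → (A → A → Set) → (B → B → Set) → A × B → A × B → Set
CartAdj AdjG AdjH (a , b) (a' , b') = (a ≡ a' × AdjH b b') ⊎ (b ≡ b' × AdjG a a')

GridAdj : (m n : ℕ) → Fin m × Fin n → Fin m × Fin n → Set
GridAdj m n = CartAdj (PathAdj m) (PathAdj n)

module Submission where

-- The grid distance is the Manhattan distance: coordinate-wise path walks
-- realise it, and every grid edge changes it by exactly one.  Consequently a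
-- vertex x lies on a geodesic from y to a corner c whenever x is in the
-- bounding box of y and c.
--
-- Upper bound.  Take the partition {(0,0)}, {(m-1,0)}, and the rest.  For any
-- two vertices, one of them lies in the bounding box of the other and one of
-- these two corners (which corner depends on the relative position), so the
-- singleton class of that corner strongly resolves them.
--
-- Lower bound.  Partitions into 0 or 1 classes are impossible in any graph
-- with two vertices.  For 2 classes, look at the square (0,0),(1,0),(0,1),(1,1):
-- two distinct vertices of one class that both have a neighbour in the other
-- class cannot be strongly resolved (their distances to it are both 1); if the
-- square avoids this, it is monochromatic, and then the distances of its four
-- vertices to the other class would have to differ by 2 along both diagonals
-- and by 1 along the sides, which is arithmetically impossible.

open import Defs
open import Data.Nat using (ℕ; zero; suc; _+_; _≤_; _<_; z≤n; s≤s; ∣_-_∣; _≤?_)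
open import Data.Nat.Properties
open import Algebra.Properties.CommutativeSemigroup +-commutativeSemigroup
  using () renaming (interchange to +-interchange)
open import Data.Fin using (Fin; toℕ; fromℕ) renaming (zero to fz; suc to fs)
open import Data.Fin.Properties using (≤fromℕ)
import Data.Fin as Fin
open import Data.Product using (_×_; _,_; ∃)
open import Data.Product.Properties using (≡-dec)
open import Data.Sum using (_⊎_; inj₁; inj₂; swap)
import Data.Sum as Sum
open import Data.Empty using (⊥; ⊥-elim)
open import Relation.Nullary using (¬_; yes; no; contradiction)
open import Relation.Unary using (_⊆_)
open import Relation.Binary.Definitions using (DecidableEquality)
open import Relation.Binary.PropositionalEquality

Gap : ℕ → ℕ → ℕ → Set
Gap a c b = a ≡ b + c ⊎ c ≡ b + a

fin1-≡ : (i j : Fin 1) → i ≡ j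
fin1-≡ fz fz = refl

fin2-≢⇒≡ : ∀ {i j k : Fin 2} → i ≢ k → j ≢ k → i ≡ j
fin2-≢⇒≡ {fz} {fz} _ _ = refl
fin2-≢⇒≡ {fs fz} {fs fz} _ _ = refl
fin2-≢⇒≡ {fz} {fs fz} {fz} i≢k _ = contradiction refl i≢k
fin2-≢⇒≡ {fz} {fs fz} {fs fz} _ j≢k = contradiction refl j≢k
fin2-≢⇒≡ {fs fz} {fz} {fz} _ j≢k = contradiction refl j≢k
fin2-≢⇒≡ {fs fz} {fz} {fs fz} i≢k _ = contradiction refl i≢k

module _ {V : Set} {Adj : V → V → Set} where

  _++ʷ_ : ∀ {x y z j k} → Walk Adj x y j → Walk Adj y z k → Walk Adj x z (j + k)
  nil ++ʷ w = w
  cons a v ++ʷ w = cons a (v ++ʷ w)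

  reverseʷ : (∀ {x y} → Adj x y → Adj y x) → ∀ {x y k} → Walk Adj x y k → Walk Adj y x k
  reverseʷ adj-sym nil = nil
  reverseʷ adj-sym (cons {k = k} a w) =
    subst (Walk Adj _ _) (+-comm k 1) (reverseʷ adj-sym w ++ʷ cons (adj-sym a) nil)

  walk₀ : ∀ {x y} → Walk Adj x y 0 → x ≡ y
  walk₀ nil = refl

  dist-unique : ∀ {x y k k′} → Dist Adj x y k → Dist Adj x y k′ → k ≡ k′
  dist-unique (w , min) (w′ , min′) = ≤-antisym (min _ w′) (min′ _ w)

  distSet-unique : ∀ {x W k k′} → DistSet Adj x W k → DistSet Adj x W k′ → k ≡ k′
  distSet-unique ((w , Ww , d) , min) ((w′ , Ww′ , d′) , min′) =
    ≤-antisym (min w′ _ Ww′ d′) (min′ w _ Ww d)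

  dist-pos : ∀ {x y k} → x ≢ y → Dist Adj x y k → 1 ≤ k
  dist-pos {k = zero} x≢y (w , _) = ⊥-elim (x≢y (walk₀ w))
  dist-pos {k = suc _} _ _ = s≤s z≤n

  distSet-pos : ∀ {x W k} → ¬ W x → DistSet Adj x W k → 1 ≤ k
  distSet-pos {x} ¬Wx ((w , Ww , d) , _) = dist-pos x≢w d
    where
    x≢w : x ≢ w
    x≢w refl = ¬Wx Ww

  adj⇒dist₁ : ∀ {x y} → Adj x y → x ≢ y → Dist Adj x y 1
  adj⇒dist₁ a x≢y = cons a nil , λ { zero w → ⊥-elim (x≢y (walk₀ w)) ; (suc j) _ → s≤s z≤n }

  distSet-singleton : ∀ {x c k} → Dist Adj x c k → DistSet Adj x (_≡ c) k
  distSet-singleton d = (_ , refl , d) , λ { _ _ refl d′ → ≤-reflexive (dist-unique d d′) }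

  distSet-cong : ∀ {x W W′ k} → W ⊆ W′ → W′ ⊆ W → DistSet Adj x W k → DistSet Adj x W′ k
  distSet-cong W⊆W′ W′⊆W ((w , Ww , d) , min) =
    (w , W⊆W′ Ww , d) , λ w j W′w → min w j (W′⊆W W′w)

  resolves-cong : ∀ {x y W W′} → W ⊆ W′ → W′ ⊆ W →
    StronglyResolves Adj W x y → StronglyResolves Adj W′ x y
  resolves-cong W⊆W′ W′⊆W (a , b , c , dx , dxy , dy , gap) =
    a , b , c , distSet-cong W⊆W′ W′⊆W dx , dxy , distSet-cong W⊆W′ W′⊆W dy , gap

  resolves⇒gap : ∀ {x y W a b c} → StronglyResolves Adj W x y →
    DistSet Adj x W a → Dist Adj x y b → DistSet Adj y W c → Gap a c b
  resolves⇒gap (_ , _ , _ , dx , dxy , dy , gap) dx′ dxy′ dy′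
    rewrite distSet-unique dx dx′ | dist-unique dxy dxy′ | distSet-unique dy dy′ = gap

  -- Two distinct vertices outside W that both have a neighbour in W are at
  -- distance 1 from W, so W cannot strongly resolve them (that would need a
  -- distance b + c ≥ 2).
  neighbours-notResolved : ∀ {x y s t W} → x ≢ y → ¬ W x → ¬ W y → W s → W t →
    Adj x s → Adj y t → ¬ StronglyResolves Adj W x y
  neighbours-notResolved {W = W} x≢y ¬Wx ¬Wy Ws Wt xs yt
    (a , b , c , dx , dxy , dy , gap) = refute gap
    where
    two≰one : ¬ (2 ≤ 1)
    two≰one (s≤s ())
    within₁ : ∀ {v w k} → ¬ W v → W w → Adj v w → DistSet Adj v W k → k ≤ 1
    within₁ ¬Wv Ww vw (_ , min) = min _ 1 Ww (adj⇒dist₁ vw λ { refl → ¬Wv Ww })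
    refute : Gap a c b → ⊥
    refute (inj₁ a≡b+c) = two≰one (≤-trans (+-mono-≤ (dist-pos x≢y dxy) (distSet-pos ¬Wy dy))
                                           (subst (_≤ 1) a≡b+c (within₁ ¬Wx Ws xs dx)))
    refute (inj₂ c≡b+a) = two≰one (≤-trans (+-mono-≤ (dist-pos x≢y dxy) (distSet-pos ¬Wx dx))
                                           (subst (_≤ 1) c≡b+a (within₁ ¬Wy Wt yt dy)))

  noPartition₀ : V → ¬ HasStrongResolvingPartition Adj 0
  noPartition₀ v (cls , _) with cls v
  ... | ()

  noPartition₁ : ∀ {x y} → x ≢ y → ¬ HasStrongResolvingPartition Adj 1
  noPartition₁ {x} {y} x≢y (cls , _ , resolving) with resolving x y x≢y (fin1-≡ _ _)
  ... | i , i≢cls , _ = i≢cls (fin1-≡ _ _)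

  module SingletonClasses (_≟_ : DecidableEquality V) (c₀ c₁ : V) where

    classOf : V → Fin 3
    classOf v with v ≟ c₀ | v ≟ c₁
    ... | yes _ | _     = fz
    ... | no _  | yes _ = fs fz
    ... | no _  | no _  = fs (fs fz)

    class₀⇒c₀ : ∀ {v} → classOf v ≡ fz → v ≡ c₀
    class₀⇒c₀ {v} with v ≟ c₀ | v ≟ c₁
    ... | yes v≡c₀ | _  = λ _ → v≡c₀
    ... | no _ | yes _  = λ ()
    ... | no _ | no _   = λ ()

    c₀⇒class₀ : ∀ {v} → v ≡ c₀ → classOf v ≡ fz
    c₀⇒class₀ {v} v≡c₀ with v ≟ c₀
    ... | yes _   = refl
    ... | no v≢c₀ = contradiction v≡c₀ v≢c₀

    class₁⇒c₁ : ∀ {v} → classOf v ≡ fs fz → v ≡ c₁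
    class₁⇒c₁ {v} with v ≟ c₀ | v ≟ c₁
    ... | yes _ | _        = λ ()
    ... | no _ | yes v≡c₁  = λ _ → v≡c₁
    ... | no _ | no _      = λ ()

    c₁⇒class₁ : c₀ ≢ c₁ → ∀ {v} → v ≡ c₁ → classOf v ≡ fs fz
    c₁⇒class₁ c₀≢c₁ {v} v≡c₁ with v ≟ c₀ | v ≟ c₁
    ... | yes v≡c₀ | _     = contradiction (trans (sym v≡c₀) v≡c₁) c₀≢c₁
    ... | no _ | yes _     = refl
    ... | no _ | no v≢c₁   = contradiction v≡c₁ v≢c₁

    outside⇒class₂ : ∀ {v} → v ≢ c₀ → v ≢ c₁ → classOf v ≡ fs (fs fz)
    outside⇒class₂ {v} v≢c₀ v≢c₁ with v ≟ c₀ | v ≟ c₁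
    ... | yes v≡c₀ | _     = contradiction v≡c₀ v≢c₀
    ... | no _ | yes v≡c₁  = contradiction v≡c₁ v≢c₁
    ... | no _ | no _      = refl

    singletonPartition : c₀ ≢ c₁ → (third : V) → third ≢ c₀ → third ≢ c₁ →
      (∀ x y → StronglyResolves Adj (_≡ c₀) x y ⊎ StronglyResolves Adj (_≡ c₁) x y) →
      HasStrongResolvingPartition Adj 3
    singletonPartition c₀≢c₁ third third≢c₀ third≢c₁ singletonResolves =
      classOf , onto , resolving
      where
      onto : ∀ i → ∃ λ v → ∀ {u} → u ≡ v → classOf u ≡ i
      onto fz = c₀ , c₀⇒class₀
      onto (fs fz) = c₁ , c₁⇒class₁ c₀≢c₁
      onto (fs (fs fz)) = third , λ { refl → outside⇒class₂ third≢c₀ third≢c₁ }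

      resolving : IsStrongResolvingPartition Adj 3 classOf
      resolving x y x≢y same with classOf x in eq
      ... | fz = ⊥-elim (x≢y (trans (class₀⇒c₀ eq) (sym (class₀⇒c₀ (sym same)))))
      ... | fs fz = ⊥-elim (x≢y (trans (class₁⇒c₁ eq) (sym (class₁⇒c₁ (sym same)))))
      ... | fs (fs fz) with singletonResolves x y
      ...   | inj₁ r = fz , (λ ()) , resolves-cong c₀⇒class₀ class₀⇒c₀ r
      ...   | inj₂ r = fs fz , (λ ()) , resolves-cong (c₁⇒class₁ c₀≢c₁) class₁⇒c₁ r

module _ {A B : Set} {AdjA : A → A → Set} {AdjB : B → B → Set} where

  liftˡ : ∀ {a a′ k} (b : B) → Walk AdjA a a′ k → Walk (CartAdj AdjA AdjB) (a , b) (a′ , b) k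
  liftˡ b nil = nil
  liftˡ b (cons e w) = cons (inj₂ (refl , e)) (liftˡ b w)

  liftʳ : ∀ {b b′ k} (a : A) → Walk AdjB b b′ k → Walk (CartAdj AdjA AdjB) (a , b) (a , b′) k
  liftʳ a nil = nil
  liftʳ a (cons e w) = cons (inj₁ (refl , e)) (liftʳ a w)

-- Distance in the path: P_m sits inside P_{m+1} as the vertices 1,…,m, and
-- this gives walks of length |i - j| by induction on i and j.
shiftʷ : ∀ {m i j k} → Walk (PathAdj m) i j k → Walk (PathAdj (suc m)) (fs i) (fs j) k
shiftʷ nil = nil
shiftʷ (cons e w) = cons (Sum.map (cong suc) (cong suc) e) (shiftʷ w)

fromZeroʷ : ∀ {m} (j : Fin (suc m)) → Walk (PathAdj (suc m)) fz j (toℕ j)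
fromZeroʷ fz = nil
fromZeroʷ (fs fz) = cons (inj₁ refl) nil
fromZeroʷ (fs (fs j)) = cons (inj₁ refl) (shiftʷ (fromZeroʷ (fs j)))

pathWalk : ∀ {m} (i j : Fin m) → Walk (PathAdj m) i j ∣ toℕ i - toℕ j ∣
pathWalk fz j = fromZeroʷ j
pathWalk (fs i) fz = reverseʷ swap (fromZeroʷ (fs i))
pathWalk (fs i) (fs j) = shiftʷ (pathWalk i j)

manhattan : ∀ {m n} → Fin m × Fin n → Fin m × Fin n → ℕ
manhattan (a , b) (c , d) = ∣ toℕ a - toℕ c ∣ + ∣ toℕ b - toℕ d ∣

manhattan-sym : ∀ {m n} (x y : Fin m × Fin n) → manhattan x y ≡ manhattan y x
manhattan-sym (a , b) (c , d) = cong₂ _+_ (∣-∣-comm (toℕ a) (toℕ c)) (∣-∣-comm (toℕ b) (toℕ d))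

manhattan-triangle : ∀ {m n} (x y z : Fin m × Fin n) →
  manhattan x z ≤ manhattan x y + manhattan y z
manhattan-triangle (a , b) (c , d) (e , f) = begin
  ∣ toℕ a - toℕ e ∣ + ∣ toℕ b - toℕ f ∣
    ≤⟨ +-mono-≤ (∣-∣-triangle (toℕ a) (toℕ c) (toℕ e)) (∣-∣-triangle (toℕ b) (toℕ d) (toℕ f)) ⟩
  (∣ toℕ a - toℕ c ∣ + ∣ toℕ c - toℕ e ∣) + (∣ toℕ b - toℕ d ∣ + ∣ toℕ d - toℕ f ∣)
    ≡⟨ +-interchange ∣ toℕ a - toℕ c ∣ ∣ toℕ c - toℕ e ∣ ∣ toℕ b - toℕ d ∣ ∣ toℕ d - toℕ f ∣ ⟩
  (∣ toℕ a - toℕ c ∣ + ∣ toℕ b - toℕ d ∣) + (∣ toℕ c - toℕ e ∣ + ∣ toℕ d - toℕ f ∣) ∎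
  where open ≤-Reasoning

∣n-1+n∣≡1 : ∀ n → ∣ n - suc n ∣ ≡ 1
∣n-1+n∣≡1 n = trans (cong ∣ n -_∣ (+-comm 1 n)) (∣m-m+n∣≡n n 1)

pathAdj⇒∣-∣≡1 : ∀ {m} {i j : Fin m} → PathAdj m i j → ∣ toℕ i - toℕ j ∣ ≡ 1
pathAdj⇒∣-∣≡1 {i = i} (inj₁ j≡1+i) rewrite j≡1+i = ∣n-1+n∣≡1 (toℕ i)
pathAdj⇒∣-∣≡1 {j = j} (inj₂ i≡1+j) rewrite i≡1+j = trans (∣-∣-comm (suc (toℕ j)) (toℕ j)) (∣n-1+n∣≡1 (toℕ j))

gridAdj⇒manhattan≡1 : ∀ {m n} {x y : Fin m × Fin n} → GridAdj m n x y → manhattan x y ≡ 1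
gridAdj⇒manhattan≡1 {x = a , _} (inj₁ (refl , e)) = cong₂ _+_ (∣n-n∣≡0 (toℕ a)) (pathAdj⇒∣-∣≡1 e)
gridAdj⇒manhattan≡1 {x = _ , b} (inj₂ (refl , e)) = cong₂ _+_ (pathAdj⇒∣-∣≡1 e) (∣n-n∣≡0 (toℕ b))

manhattan≤length : ∀ {m n} {x y : Fin m × Fin n} {k} → Walk (GridAdj m n) x y k → manhattan x y ≤ k
manhattan≤length {x = a , b} nil = ≤-reflexive (cong₂ _+_ (∣n-n∣≡0 (toℕ a)) (∣n-n∣≡0 (toℕ b)))
manhattan≤length {x = x} {z} (cons {y = y} {k = k} e w) = begin
  manhattan x z                 ≤⟨ manhattan-triangle x y z ⟩
  manhattan x y + manhattan y z ≡⟨ cong (_+ manhattan y z) (gridAdj⇒manhattan≡1 e) ⟩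
  suc (manhattan y z)           ≤⟨ s≤s (manhattan≤length w) ⟩
  suc k                         ∎
  where open ≤-Reasoning

gridDist : ∀ {m n} (x y : Fin m × Fin n) → Dist (GridAdj m n) x y (manhattan x y)
gridDist (a , b) (c , d) =
  liftˡ b (pathWalk a c) ++ʷ liftʳ c (pathWalk b d) , λ _ → manhattan≤length

Between : ℕ → ℕ → ℕ → Set
Between u x v = (u ≤ x × x ≤ v) ⊎ (v ≤ x × x ≤ u)

∣-∣-ascending : ∀ {u x v} → u ≤ x → x ≤ v → ∣ u - v ∣ ≡ ∣ u - x ∣ + ∣ x - v ∣
∣-∣-ascending {u} u≤x x≤v with m≤n⇒∃[o]m+o≡n u≤x
... | p , refl with m≤n⇒∃[o]m+o≡n x≤v
...   | q , refl = begin
  ∣ u - u + p + q ∣                   ≡⟨ cong ∣ u -_∣ (+-assoc u p q) ⟩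
  ∣ u - u + (p + q) ∣                 ≡⟨ ∣m-m+n∣≡n u (p + q) ⟩
  p + q                               ≡⟨ sym (cong₂ _+_ (∣m-m+n∣≡n u p) (∣m-m+n∣≡n (u + p) q)) ⟩
  ∣ u - u + p ∣ + ∣ u + p - u + p + q ∣ ∎
  where open ≡-Reasoning

∣-∣-between : ∀ {u x v} → Between u x v → ∣ u - v ∣ ≡ ∣ u - x ∣ + ∣ x - v ∣
∣-∣-between (inj₁ (u≤x , x≤v)) = ∣-∣-ascending u≤x x≤v
∣-∣-between {u} {x} {v} (inj₂ (v≤x , x≤u)) = begin
  ∣ u - v ∣             ≡⟨ ∣-∣-comm u v ⟩
  ∣ v - u ∣             ≡⟨ ∣-∣-ascending v≤x x≤u ⟩
  ∣ v - x ∣ + ∣ x - u ∣ ≡⟨ +-comm ∣ v - x ∣ ∣ x - u ∣ ⟩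
  ∣ x - u ∣ + ∣ v - x ∣ ≡⟨ cong₂ _+_ (∣-∣-comm x u) (∣-∣-comm v x) ⟩
  ∣ u - x ∣ + ∣ x - v ∣ ∎
  where open ≡-Reasoning

InBox : ∀ {m n} → Fin m × Fin n → Fin m × Fin n → Fin m × Fin n → Set
InBox (a , b) (c , d) (e , f) = Between (toℕ a) (toℕ c) (toℕ e) × Between (toℕ b) (toℕ d) (toℕ f)

manhattan-inBox : ∀ {m n} {u x v : Fin m × Fin n} → InBox u x v →
  manhattan u v ≡ manhattan u x + manhattan x v
manhattan-inBox {u = a , b} {c , d} {e , f} (rows , cols) =
  trans (cong₂ _+_ (∣-∣-between rows) (∣-∣-between cols))
        (+-interchange ∣ toℕ a - toℕ c ∣ ∣ toℕ c - toℕ e ∣ ∣ toℕ b - toℕ d ∣ ∣ toℕ d - toℕ f ∣)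

singleton-resolves : ∀ {m n} {x y c : Fin m × Fin n} → InBox x y c ⊎ InBox y x c →
  StronglyResolves (GridAdj m n) (_≡ c) x y
singleton-resolves {x = x} {y} {c} between =
  _ , _ , _ , distSet-singleton (gridDist x c) , gridDist x y , distSet-singleton (gridDist y c) ,
  gap between
  where
  gap : InBox x y c ⊎ InBox y x c → Gap (manhattan x c) (manhattan y c) (manhattan x y)
  gap (inj₁ y-between) = inj₁ (manhattan-inBox y-between)
  gap (inj₂ x-between) = inj₂ (trans (manhattan-inBox x-between) (cong (_+ manhattan x c) (manhattan-sym y x)))

origin farCorner : ∀ {m n} → Fin (suc m) × Fin (suc n)
origin = fz , fz
farCorner {m} = fromℕ m , fz

-- Any two vertices are strongly resolved by one of the two lower corners:
-- by the origin if one dominates the other coordinate-wise, and by the far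
-- corner otherwise.
corner-resolves : ∀ {m n} (x y : Fin (suc m) × Fin (suc n)) →
  StronglyResolves (GridAdj (suc m) (suc n)) (_≡ origin) x y ⊎
  StronglyResolves (GridAdj (suc m) (suc n)) (_≡ farCorner) x y
corner-resolves (a , b) (c , d) with toℕ c ≤? toℕ a | toℕ d ≤? toℕ b
... | yes c≤a | yes d≤b = inj₁ (singleton-resolves (inj₁ (inj₂ (z≤n , c≤a) , inj₂ (z≤n , d≤b))))
... | no c≰a  | no d≰b  = inj₁ (singleton-resolves (inj₂ (inj₂ (z≤n , ≰⇒≥ c≰a) , inj₂ (z≤n , ≰⇒≥ d≰b))))
... | yes c≤a | no d≰b  = inj₂ (singleton-resolves (inj₂ (inj₁ (c≤a , ≤fromℕ a) , inj₂ (z≤n , ≰⇒≥ d≰b))))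
... | no c≰a  | yes d≤b = inj₂ (singleton-resolves (inj₁ (inj₁ (≰⇒≥ c≰a , ≤fromℕ c) , inj₂ (z≤n , d≤b))))

-- Around a 4-cycle p r q s (p, q opposite and r, s opposite) the distances to
-- a set cannot differ by 2 across both diagonals and by 1 along all sides:
-- r and s would both be the midpoint of p and q, yet differ by 2.
squareGaps-absurd : ∀ {p q r s} → Gap p q 2 → Gap p r 1 → Gap p s 1 →
  Gap q r 1 → Gap q s 1 → Gap r s 2 → ⊥
squareGaps-absurd (inj₁ refl) (inj₁ refl) (inj₁ refl) _ _ (inj₁ ())
squareGaps-absurd (inj₁ refl) (inj₁ refl) (inj₁ refl) _ _ (inj₂ ())
squareGaps-absurd (inj₁ refl) (inj₁ refl) (inj₂ refl) _ (inj₁ ()) _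
squareGaps-absurd (inj₁ refl) (inj₁ refl) (inj₂ refl) _ (inj₂ ()) _
squareGaps-absurd (inj₁ refl) (inj₂ refl) _ (inj₁ ()) _ _
squareGaps-absurd (inj₁ refl) (inj₂ refl) _ (inj₂ ()) _ _
squareGaps-absurd (inj₂ refl) _ _ (inj₁ refl) (inj₁ refl) (inj₁ ())
squareGaps-absurd (inj₂ refl) _ _ (inj₁ refl) (inj₁ refl) (inj₂ ())
squareGaps-absurd (inj₂ refl) _ (inj₁ ()) (inj₁ refl) (inj₂ refl) _
squareGaps-absurd (inj₂ refl) _ (inj₂ ()) (inj₁ refl) (inj₂ refl) _
squareGaps-absurd (inj₂ refl) (inj₁ ()) _ (inj₂ refl) _ _
squareGaps-absurd (inj₂ refl) (inj₂ ()) _ (inj₂ refl) _ _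

module TwoClasses {m n : ℕ}
  (cls : Fin (suc (suc m)) × Fin (suc (suc n)) → Fin 2)
  (resolving : IsStrongResolvingPartition (GridAdj (suc (suc m)) (suc (suc n))) 2 cls) where

  private
    V = Fin (suc (suc m)) × Fin (suc (suc n))
    G = GridAdj (suc (suc m)) (suc (suc n))

  v₀₀ v₁₀ v₀₁ v₁₁ : V
  v₀₀ = fz , fz
  v₁₀ = fs fz , fz
  v₀₁ = fz , fs fz
  v₁₁ = fs fz , fs fz

  rowStep⁺ : ∀ {b} → G (fz , b) (fs fz , b)
  rowStep⁺ = inj₂ (refl , inj₁ refl)
  rowStep⁻ : ∀ {b} → G (fs fz , b) (fz , b)
  rowStep⁻ = inj₂ (refl , inj₂ refl)
  colStep⁺ : ∀ {a} → G (a , fz) (a , fs fz)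
  colStep⁺ = inj₁ (refl , inj₁ refl)
  colStep⁻ : ∀ {a} → G (a , fs fz) (a , fz)
  colStep⁻ = inj₁ (refl , inj₂ refl)

  Other : Fin 2 → V → Set
  Other k v = cls v ≢ k

  resolvedByOther : ∀ {x y k} → x ≢ y → cls x ≡ k → cls y ≡ k → StronglyResolves G (Other k) x y
  resolvedByOther {x} {y} x≢y refl y-same with resolving x y x≢y (sym y-same)
  ... | i , i≢k , r =
    resolves-cong (λ clsv≡i clsv≡k → i≢k (trans (sym clsv≡i) clsv≡k)) (λ clsv≢k → fin2-≢⇒≡ clsv≢k i≢k) r

  neighbours-absurd : ∀ {x y s t} → x ≢ y → cls x ≡ cls y → cls s ≢ cls x → cls t ≢ cls x →
    G x s → G y t → ⊥
  neighbours-absurd x≢y same s-other t-other xs yt =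
    neighbours-notResolved x≢y (λ ne → ne refl) (λ ne → ne (sym same)) s-other t-other xs yt
      (resolvedByOther x≢y refl (sym same))

  monochromatic-absurd : ∀ {k} → cls v₀₀ ≡ k → cls v₁₀ ≡ k → cls v₀₁ ≡ k → cls v₁₁ ≡ k → ⊥
  monochromatic-absurd {k} e₀₀ e₁₀ e₀₁ e₁₁
    with resolvedByOther (λ ()) e₀₀ e₁₁ | resolvedByOther (λ ()) e₁₀ e₀₁
  ... | _ , _ , _ , d₀₀ , _ , d₁₁ , _ | _ , _ , _ , d₁₀ , _ , d₀₁ , _ =
    squareGaps-absurd (gap e₀₀ e₁₁ d₀₀ d₁₁ (λ ())) (gap e₀₀ e₁₀ d₀₀ d₁₀ (λ ())) (gap e₀₀ e₀₁ d₀₀ d₀₁ (λ ()))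
                      (gap e₁₁ e₁₀ d₁₁ d₁₀ (λ ())) (gap e₁₁ e₀₁ d₁₁ d₀₁ (λ ())) (gap e₁₀ e₀₁ d₁₀ d₀₁ (λ ()))
    where
    gap : ∀ {x y a c} → cls x ≡ k → cls y ≡ k → DistSet G x (Other k) a → DistSet G y (Other k) c →
      x ≢ y → Gap a c (manhattan x y)
    gap ex ey dx dy x≢y = resolves⇒gap (resolvedByOther x≢y ex ey) dx (gridDist _ _) dy

-- Every 2-colouring of the corner square either is monochromatic or has two
-- equally coloured vertices with neighbours of the other colour.
noPartition₂ : ∀ {m n} → ¬ HasStrongResolvingPartition (GridAdj (suc (suc m)) (suc (suc n))) 2
noPartition₂ (cls , _ , resolving) = squareColouring
  where
  open TwoClasses cls resolving
  squareColouring : ⊥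
  squareColouring with cls v₁₁ Fin.≟ cls v₀₀ | cls v₁₀ Fin.≟ cls v₀₀ | cls v₀₁ Fin.≟ cls v₀₀
  ... | yes e₁₁ | yes e₁₀ | yes e₀₁ = monochromatic-absurd refl e₁₀ e₀₁ e₁₁
  ... | yes e₁₁ | no n₁₀  | _       = neighbours-absurd (λ ()) (sym e₁₁) n₁₀ n₁₀ rowStep⁺ colStep⁻
  ... | yes e₁₁ | yes _   | no n₀₁  = neighbours-absurd (λ ()) (sym e₁₁) n₀₁ n₀₁ colStep⁺ rowStep⁻
  ... | no n₁₁  | yes e₁₀ | yes e₀₁ =
    neighbours-absurd (λ ()) (trans e₁₀ (sym e₀₁)) (λ e → n₁₁ (trans e e₁₀)) (λ e → n₁₁ (trans e e₁₀)) colStep⁺ rowStep⁺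
  ... | no n₁₁  | yes e₁₀ | no n₀₁  = neighbours-absurd (λ ()) (sym e₁₀) n₀₁ n₁₁ colStep⁺ colStep⁺
  ... | no n₁₁  | no n₁₀  | yes e₀₁ = neighbours-absurd (λ ()) (sym e₀₁) n₁₀ n₁₁ rowStep⁺ rowStep⁺
  ... | no n₁₁  | no n₁₀  | no n₀₁  =
    neighbours-absurd (λ ()) (fin2-≢⇒≡ n₁₀ n₀₁) (λ e → n₁₀ (sym e)) (λ e → n₁₀ (sym e)) rowStep⁻ colStep⁻

theorem22 : (m n : ℕ) → 2 ≤ m → 2 ≤ n → StrongPartitionDimension (GridAdj m n) 3
theorem22 (suc (suc m)) (suc (suc n)) (s≤s (s≤s z≤n)) (s≤s (s≤s z≤n)) =
  singletonPartition (λ ()) (fz , fs fz) (λ ()) (λ ()) corner-resolves , lowerBound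
  where
  open SingletonClasses {Adj = GridAdj (suc (suc m)) (suc (suc n))} (≡-dec Fin._≟_ Fin._≟_) origin farCorner
  lowerBound : ∀ j → j < 3 → ¬ HasStrongResolvingPartition (GridAdj (suc (suc m)) (suc (suc n))) j
  lowerBound 0 _ = noPartition₀ origin
  lowerBound 1 _ = noPartition₁ {x = origin} {y = fz , fs fz} (λ ())
  lowerBound 2 _ = noPartition₂
  lowerBound (suc (suc (suc j))) (s≤s (s≤s (s≤s ())))
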